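{- Let $\chi_{\mathrm{OPT}}$ and $\chi_{\mathrm{OFF}}$ be two red/blue colorings of the nodes of the $n$-node cycle with cut-edge sets $\mathcal{C}_{\mathrm{OPT}}$ and $\mathcal{C}_{\mathrm{OFF}}$ satisfying $\mathcal{C}_{\mathrm{OFF}}\subseteq\mathcal{C}_{\mathrm{OPT}}$. Then $\Phi$ (defined below) is a minimum-cardinality set of nodes whose recoloring turns $\chi_{\mathrm{OFF}}$ into a coloring that is either identical to $\chi_{\mathrm{OPT}}$ or equal to $\chi_{\mathrm{OPT}}$ with the two colors swapped.
   Context: Cycle on nodes $v_1,\dots,v_n$ with edges $(v_1,v_2),\dots,(v_n,v_1)$, with a fixed clockwise orientation. The cut-edges of a coloring are the cycle edges whose endpoints have different colors. For cycle edges $c_i,c_j$, the clockwise arc $A^\circ(c_i,c_j)$ is the set of nodes encountered when moving clockwise from $c_i$ to $c_j$. Definition of $\Phi$: if $\mathcal{C}_{\mathrm{OPT}}=\mathcal{C}_{\mathrm{OFF}}$ then $\Phi=\emptyset$. Otherwise, let $c_1,\dots,c_m$ be the edges of $\mathcal{C}_{\mathrm{OPT}}\setminus\mathcal{C}_{\mathrm{OFF}}$ in clockwise order ($m$ is even), and set $\Phi_0=A^\circ(c_1,c_2)\uplus A^\circ(c_3,c_4)\uplus\dots\uplus A^\circ(c_{m-1},c_m)$ and $\Phi_1=A^\circ(c_m,c_1)\uplus A^\circ(c_2,c_3)\uplus\dots\uplus A^\circ(c_{m-2},c_{m-1})$; $\Phi$ is the smaller of $\Phi_0,\Phi_1$ (ties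 broken arbitrarily). -}

module Defs where

open import Data.Nat using (ℕ; zero; suc; _+_; _∸_; _≤_; _≤ᵇ_; _<ᵇ_)
open import Data.Nat.DivMod using (_%_; m%n<n)
open import Data.Fin using (Fin; toℕ; fromℕ<)
open import Data.Fin.Subset using (Subset; ⊥; ∣_∣)
open import Data.Bool using (Bool; true; false; not; _∧_; _∨_; _xor_; if_then_else_)
open import Data.Vec using (Vec; tabulate; lookup)
open import Data.List using (List; []; _∷_; _++_; [_]; filter)
open import Data.Bool.ListAction using (any)
open import Data.List as L using ()
open import Data.Product using (_×_; _,_)
open import Data.Sum using (_⊎_)
open import Relation.Binary.PropositionalEquality using (_≡_; _≢_)
open import Relation.Nullary using (¬_)
open import Relation.Nullary.Decidable using (does)
open import Data.Bool.Properties using () renaming (_≟_ to _≟B_)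

-- The n-node cycle: nodes v_0,…,v_{n-1} are Fin n; cycle edge i is (v_i, v_{i+1 mod n}).
-- Clockwise = increasing index (mod n).

next : {n : ℕ} → Fin n → Fin n
next {suc m} i = fromℕ< (m%n<n (suc (toℕ i)) (suc m))

-- a red/blue coloring (true = red, false = blue)
Coloring : ℕ → Set
Coloring n = Fin n → Bool

isCut : {n : ℕ} → Coloring n → Fin n → Bool
isCut χ i = not (does (χ i ≟B χ (next i)))

CutEdges : {n : ℕ} → Coloring n → Subset n
CutEdges χ = tabulate (isCut χ)

cwDist : {n : ℕ} → Fin n → Fin n → ℕ
cwDist {suc m} a b = ((toℕ b + suc m) ∸ toℕ a) % suc m

-- node v lies in the clockwise arc A°(c_a, c_b) from edge c_a = (v_a,v_{a+1})
-- to edge c_b = (v_b,v_{b+1}): the nodes v_{a+1}, …, v_b.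
inArc : {n : ℕ} → Fin n → Fin n → Fin n → Bool
inArc a b v = (1 ≤ᵇ cwDist a v) ∧ (cwDist a v ≤ᵇ cwDist a b)

Arc : {n : ℕ} → Fin n → Fin n → Subset n
Arc a b = tabulate (inArc a b)

diffEdges : {n : ℕ} → Coloring n → Coloring n → List (Fin n)
diffEdges {n} χOPT χOFF =
  filter (λ e → isCut χOPT e ∧ not (isCut χOFF e) ≟B true) (L.allFin n)

pairsUp : {A : Set} → List A → List (A × A)
pairsUp (a ∷ b ∷ rest) = (a , b) ∷ pairsUp rest
pairsUp _ = []

rotL : {A : Set} → List A → List A
rotL [] = []
rotL (x ∷ xs) = xs ++ [ x ]

unionArcs : {n : ℕ} → List (Fin n × Fin n) → Subset n
unionArcs ps = tabulate (λ v → any (λ { (a , b) → inArc a b v }) ps)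

Φ₀ : {n : ℕ} → Coloring n → Coloring n → Subset n
Φ₀ χOPT χOFF = unionArcs (pairsUp (diffEdges χOPT χOFF))

-- Φ₁ = A°(c2,c3) ⊎ … ⊎ A°(c_{m-2},c_{m-1}) ⊎ A°(c_m,c1)
Φ₁ : {n : ℕ} → Coloring n → Coloring n → Subset n
Φ₁ χOPT χOFF = unionArcs (pairsUp (rotL (diffEdges χOPT χOFF)))

-- Φ is a valid choice of the set Φ (ties broken arbitrarily)
IsPhi : {n : ℕ} → Coloring n → Coloring n → Subset n → Set
IsPhi χOPT χOFF Φ =
  (CutEdges χOPT ≡ CutEdges χOFF → Φ ≡ ⊥) ×
  (CutEdges χOPT ≢ CutEdges χOFF →
     (Φ ≡ Φ₀ χOPT χOFF × ∣ Φ₀ χOPT χOFF ∣ ≤ ∣ Φ₁ χOPT χOFF ∣)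
   ⊎ (Φ ≡ Φ₁ χOPT χOFF × ∣ Φ₁ χOPT χOFF ∣ ≤ ∣ Φ₀ χOPT χOFF ∣))

recolor : {n : ℕ} → Coloring n → Subset n → Coloring n
recolor χ S v = lookup S v xor χ v

Reaches : {n : ℕ} → Coloring n → Coloring n → Subset n → Set
Reaches χOFF χOPT S =
  (∀ v → recolor χOFF S v ≡ χOPT v) ⊎ (∀ v → recolor χOFF S v ≡ not (χOPT v))

IsMinRecoloring : {n : ℕ} → Coloring n → Coloring n → Subset n → Set
IsMinRecoloring χOFF χOPT S =
  Reaches χOFF χOPT S × (∀ T → Reaches χOFF χOPT T → ∣ S ∣ ≤ ∣ T ∣)

-- Write D v = χOPT v xor χOFF v. Recoloring T turns χOFF into χOPT or its swap exactly when T is D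
-- or its complement, so a minimum recoloring is the smaller of these two sets. As C_OFF ⊆ C_OPT,
-- the edges of C_OPT ∖ C_OFF are exactly the edges across which D changes; summing these changes
-- from node 0 onward telescopes, so D v xor D 0 is the parity of the number of such edges before v,
-- and that number is even once the whole cycle has been traversed. On the other hand, the arcs
-- A°(c₁,c₂), A°(c₃,c₄), … consist of exactly the nodes preceded by an odd number of the c_i, so Φ₀
-- is that parity set and Φ₁ is its complement. Hence {Φ₀, Φ₁} = {D, complement of D}, and Φ, the
-- smaller of the two, is a minimum recoloring.

module Submission where

open import Defs
open import Algebra using (CommutativeRing; CommutativeMonoid)
import Algebra.Properties.CommutativeSemigroup
open import Data.Bool using (Bool; true; false; not; _∧_; _∨_; _xor_)
open import Data.Bool.Properties
  using (not-involutive; not-distribˡ-xor; xor-assoc; xor-same; xor-identityʳ; xor-∧-commutativeRing;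
         ∧-identityʳ; ∧-zeroʳ; ∧-inverseʳ; ∨-identityʳ; ∨-comm; ∨-commutativeMonoid)
  renaming (_≟_ to _≟B_)
open import Data.Bool.ListAction using (any)
open import Data.Fin as Fin using (Fin; zero; suc; toℕ; fromℕ<)
open import Data.Fin.Properties using (toℕ<n; toℕ-fromℕ<; fromℕ<-toℕ; toℕ-injective)
open import Data.Fin.Subset using (Subset; _⊆_; ⊥; ∣_∣)
open import Data.Fin.Subset.Properties using (∣⊥∣≡0)
open import Data.List using (List; []; _∷_; _++_; [_]; filter; allFin)
import Data.List as List
open import Data.List.Properties using (filter-none)
open import Data.List.Relation.Unary.All as All using (All; []; _∷_)
open import Data.List.Relation.Unary.AllPairs using (AllPairs; []; _∷_)
import Data.List.Relation.Unary.AllPairs.Properties as AllPairs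
open import Data.Nat using (ℕ; zero; suc; _+_; _∸_; _≤_; _<_; _≤ᵇ_; _<ᵇ_; _≤?_; _<?_; z≤n; s<s⁻¹)
open import Data.Nat.DivMod using (_%_; m<n⇒m%n≡m; [m+n]%n≡m%n; n%n≡0)
open import Data.Nat.Properties
  using (≤ᵇ⇒≤; ≤⇒≤ᵇ; ≤ᵇ-reflects-≤; ≤-trans; ≤-reflexive; <-trans; <⇒≤; <⇒≱; ≤⇒≯; ≤-<-connex;
         ≤-<-trans; <-≤-trans; n<1+n; m≤n+m; m∸n≤m; +-∸-comm; m∸n+n≡m; m<n+o⇒m∸n<o;
         +-monoˡ-≤; +-monoˡ-<; +-cancelʳ-≤)
open import Data.Product using (_×_; _,_; proj₁)
open import Data.Sum using (_⊎_; inj₁; inj₂; [_,_]′)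
open import Data.Vec using (lookup; tabulate)
open import Data.Vec.Properties
  using (lookup∘tabulate; tabulate∘lookup; tabulate-cong; lookup-replicate; []=⇒lookup; lookup⇒[]=; ≡-dec)
open import Data.Vec.Functional using (foldr)
open import Function using (_∘_; id; _⇔_; mk⇔; Equivalence)
import Function.Properties.Equivalence as ⇔
open import Relation.Binary.PropositionalEquality
  using (_≡_; _≢_; _≗_; refl; sym; trans; cong; cong₂; subst; module ≡-Reasoning)
open import Relation.Nullary using (yes; no; does; contradiction)
open import Relation.Nullary.Decidable using (dec-true; dec-false)
open import Relation.Nullary.Reflects using (det; fromEquivalence)

open ≡-Reasoning

private
  variable
    n k : ℕ

data IsSideOf (f : Fin n → Bool) (T : Subset n) : Set where
  equal      : lookup T ≗ f       → IsSideOf f T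
  complement : lookup T ≗ not ∘ f → IsSideOf f T

record IsSmallerSideOf (f : Fin n → Bool) (S : Subset n) : Set where
  constructor smallerSide
  field
    isSideOf     : IsSideOf f S
    ≤-equal      : ∣ S ∣ ≤ ∣ tabulate f ∣
    ≤-complement : ∣ S ∣ ≤ ∣ tabulate (not ∘ f) ∣

isSideOf-cong : ∀ {f g : Fin n → Bool} {T} → f ≗ g → IsSideOf f T → IsSideOf g T
isSideOf-cong f≗g (equal T≗f)       = equal (λ v → trans (T≗f v) (f≗g v))
isSideOf-cong f≗g (complement T≗¬f) = complement (λ v → trans (T≗¬f v) (cong not (f≗g v)))

isSideOf-not : ∀ {f : Fin n → Bool} {T} → IsSideOf f T → IsSideOf (not ∘ f) T
isSideOf-not (equal T≗f)       = complement (λ v → trans (T≗f v) (sym (not-involutive _)))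
isSideOf-not (complement T≗¬f) = equal T≗¬f

isSideOf-xor : ∀ {f : Fin n → Bool} {T} d → IsSideOf f T ⇔ IsSideOf (λ v → d xor f v) T
isSideOf-xor false = ⇔.refl
isSideOf-xor true  = mk⇔ isSideOf-not (isSideOf-cong (not-involutive ∘ _) ∘ isSideOf-not)

∣∣≡∣tabulate∣ : ∀ (T : Subset n) {f} → lookup T ≗ f → ∣ T ∣ ≡ ∣ tabulate f ∣
∣∣≡∣tabulate∣ T T≗f = cong ∣_∣ (trans (sym (tabulate∘lookup T)) (tabulate-cong T≗f))

∣∣≡0 : ∀ (S : Subset n) → (∀ v → lookup S v ≡ false) → ∣ S ∣ ≡ 0
∣∣≡0 {n} S S≗false = begin
  ∣ S ∣                              ≡⟨ ∣∣≡∣tabulate∣ S S≗false ⟩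
  ∣ tabulate {n = n} (λ _ → false) ∣ ≡⟨ ∣∣≡∣tabulate∣ (⊥ {n = n}) (λ v → lookup-replicate v false) ⟨
  ∣ ⊥ {n = n} ∣                      ≡⟨ ∣⊥∣≡0 n ⟩
  0                                  ∎

module _ {f : Fin n → Bool} where

  smallerSide-minimal : ∀ {S T} → IsSmallerSideOf f S → IsSideOf f T → ∣ S ∣ ≤ ∣ T ∣
  smallerSide-minimal {T = T} S-smaller (equal T≗f) =
    subst (_ ≤_) (sym (∣∣≡∣tabulate∣ T T≗f)) (IsSmallerSideOf.≤-equal S-smaller)
  smallerSide-minimal {T = T} S-smaller (complement T≗¬f) =
    subst (_ ≤_) (sym (∣∣≡∣tabulate∣ T T≗¬f)) (IsSmallerSideOf.≤-complement S-smaller)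

  empty-isSmallerSideOf : ∀ S → (∀ v → f v ≡ false) → (∀ v → lookup S v ≡ false) → IsSmallerSideOf f S
  empty-isSmallerSideOf S f≗false S≗false =
    smallerSide (equal (λ v → trans (S≗false v) (sym (f≗false v)))) S≤ S≤
    where
    S≤ : ∀ {k} → ∣ S ∣ ≤ k
    S≤ = ≤-trans (≤-reflexive (∣∣≡0 S S≗false)) z≤n

  smallerOf-isSmallerSideOf : ∀ {S} A B → lookup A ≗ f → lookup B ≗ not ∘ f →
    (S ≡ A × ∣ A ∣ ≤ ∣ B ∣) ⊎ (S ≡ B × ∣ B ∣ ≤ ∣ A ∣) → IsSmallerSideOf f S
  smallerOf-isSmallerSideOf A B A≗f B≗¬f (inj₁ (refl , A≤B)) =
    smallerSide (equal A≗f) (≤-reflexive (∣∣≡∣tabulate∣ A A≗f))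
                (subst (_ ≤_) (∣∣≡∣tabulate∣ B B≗¬f) A≤B)
  smallerOf-isSmallerSideOf A B A≗f B≗¬f (inj₂ (refl , B≤A)) =
    smallerSide (complement B≗¬f) (subst (_ ≤_) (∣∣≡∣tabulate∣ A A≗f) B≤A)
                (≤-reflexive (∣∣≡∣tabulate∣ B B≗¬f))

disagree : Coloring n → Coloring n → Fin n → Bool
disagree χ χ′ v = χ v xor χ′ v

xor-cancelʳ : ∀ x y → (x xor y) xor y ≡ x
xor-cancelʳ x y = trans (xor-assoc x y y) (trans (cong (x xor_) (xor-same y)) (xor-identityʳ x))

xor-≡⇔ : ∀ t o p → t xor o ≡ p ⇔ t ≡ p xor o
xor-≡⇔ t o p = mk⇔ (λ e → trans (sym (xor-cancelʳ t o)) (cong (_xor o) e))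
                   (λ e → trans (cong (_xor o) e) (xor-cancelʳ p o))

module _ {χOFF χOPT : Coloring n} where

  reaches⇔isSideOf : ∀ T → Reaches χOFF χOPT T ⇔ IsSideOf (disagree χOPT χOFF) T
  reaches⇔isSideOf T = mk⇔
    [ (λ r → equal λ v → to (xor-≡⇔ (lookup T v) _ _) (r v))
    , (λ r → complement λ v → trans (to (xor-≡⇔ (lookup T v) _ _) (r v)) (sym (not-distrib v)))
    ]′
    λ { (equal T≗d)       → inj₁ λ v → from (xor-≡⇔ (lookup T v) _ _) (T≗d v)
      ; (complement T≗¬d) → inj₂ λ v → from (xor-≡⇔ (lookup T v) _ _) (trans (T≗¬d v) (not-distrib v)) }
    where
    open Equivalence
    not-distrib : ∀ v → not (χOPT v xor χOFF v) ≡ not (χOPT v) xor χOFF v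
    not-distrib v = not-distribˡ-xor (χOPT v) (χOFF v)

  smallerSide⇒isMinRecoloring : ∀ {f S} d → (∀ v → f v ≡ d xor disagree χOPT χOFF v) →
    IsSmallerSideOf f S → IsMinRecoloring χOFF χOPT S
  smallerSide⇒isMinRecoloring {f} {S} d f≗ S-smaller =
    from (reaches⇔ S) (IsSmallerSideOf.isSideOf S-smaller) ,
    λ T → smallerSide-minimal S-smaller ∘ to (reaches⇔ T)
    where
    open Equivalence
    reaches⇔ : ∀ T → Reaches χOFF χOPT T ⇔ IsSideOf f T
    reaches⇔ T = ⇔.trans (reaches⇔isSideOf T)
                   (⇔.trans (isSideOf-xor d) (mk⇔ (isSideOf-cong (sym ∘ f≗)) (isSideOf-cong f≗)))

<ᵇ-true : ∀ {i j} → i < j → (i <ᵇ j) ≡ true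
<ᵇ-true = dec-true (_ <? _)

<ᵇ-false : ∀ {i j} → j ≤ i → (i <ᵇ j) ≡ false
<ᵇ-false = dec-false (_ <? _) ∘ ≤⇒≯

≤ᵇ-true : ∀ {i j} → i ≤ j → (i ≤ᵇ j) ≡ true
≤ᵇ-true = dec-true (_ ≤? _)

≤ᵇ-false : ∀ {i j} → j < i → (i ≤ᵇ j) ≡ false
≤ᵇ-false = dec-false (_ ≤? _) ∘ <⇒≱

≤ᵇ-cong : ∀ {i j i′ j′} → (i ≤ j ⇔ i′ ≤ j′) → (i ≤ᵇ j) ≡ (i′ ≤ᵇ j′)
≤ᵇ-cong {i} {j} {i′} {j′} i≤j⇔ =
  det (fromEquivalence (to ∘ ≤ᵇ⇒≤ i j) (≤⇒≤ᵇ ∘ from)) (≤ᵇ-reflects-≤ i′ j′)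
  where open Equivalence i≤j⇔

≤ᵇ-+ʳ : ∀ o {i j} → (i ≤ᵇ j) ≡ (i + o ≤ᵇ j + o)
≤ᵇ-+ʳ o {i} {j} = ≤ᵇ-cong (mk⇔ (+-monoˡ-≤ o) (+-cancelʳ-≤ o i j))

module _ {m : ℕ} {a : Fin (suc m)} where

  cwDist-unwrap : ∀ {x} → toℕ a ≤ toℕ x → cwDist a x + toℕ a ≡ toℕ x
  cwDist-unwrap {x} a≤x = begin
    (toℕ x + suc m ∸ toℕ a) % suc m + toℕ a ≡⟨ cong (λ d → d % suc m + toℕ a) (+-∸-comm (suc m) a≤x) ⟩
    (toℕ x ∸ toℕ a + suc m) % suc m + toℕ a ≡⟨ cong (_+ toℕ a) ([m+n]%n≡m%n (toℕ x ∸ toℕ a) (suc m)) ⟩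
    (toℕ x ∸ toℕ a) % suc m + toℕ a         ≡⟨ cong (_+ toℕ a) (m<n⇒m%n≡m x∸a<n) ⟩
    toℕ x ∸ toℕ a + toℕ a                   ≡⟨ m∸n+n≡m a≤x ⟩
    toℕ x                                   ∎
    where x∸a<n = ≤-<-trans (m∸n≤m (toℕ x) (toℕ a)) (toℕ<n x)

  cwDist-wrap : ∀ {x} → toℕ x < toℕ a → cwDist a x + toℕ a ≡ toℕ x + suc m
  cwDist-wrap {x} x<a = begin
    (toℕ x + suc m ∸ toℕ a) % suc m + toℕ a ≡⟨ cong (_+ toℕ a) (m<n⇒m%n≡m x+n∸a<n) ⟩
    toℕ x + suc m ∸ toℕ a + toℕ a           ≡⟨ m∸n+n≡m (≤-trans (<⇒≤ (toℕ<n a)) (m≤n+m (suc m) (toℕ x))) ⟩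
    toℕ x + suc m                           ∎
    where x+n∸a<n = m<n+o⇒m∸n<o (toℕ x + suc m) (toℕ a) (+-monoˡ-< (suc m) x<a)

  inArc-shift : ∀ {b v i j} → cwDist a v + toℕ a ≡ i → cwDist a b + toℕ a ≡ j →
                inArc a b v ≡ (toℕ a <ᵇ i) ∧ (i ≤ᵇ j)
  inArc-shift {b} {v} refl refl =
    cong₂ _∧_ (≤ᵇ-+ʳ (toℕ a) {1} {cwDist a v}) (≤ᵇ-+ʳ (toℕ a) {cwDist a v} {cwDist a b})

  inArc-≤ : ∀ {b} v → toℕ a ≤ toℕ b → inArc a b v ≡ (toℕ a <ᵇ toℕ v) ∧ (toℕ v ≤ᵇ toℕ b)
  inArc-≤ {b} v a≤b with ≤-<-connex (toℕ a) (toℕ v)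
  ... | inj₁ a≤v = inArc-shift (cwDist-unwrap a≤v) (cwDist-unwrap a≤b)
  ... | inj₂ v<a
    rewrite inArc-shift (cwDist-wrap v<a) (cwDist-unwrap a≤b)
          | ≤ᵇ-false (≤-trans (toℕ<n b) (m≤n+m (suc m) (toℕ v)))
          | <ᵇ-false (<⇒≤ v<a)
          = ∧-zeroʳ _

  inArc-> : ∀ {b} v → toℕ b < toℕ a → inArc a b v ≡ (toℕ a <ᵇ toℕ v) ∨ (toℕ v ≤ᵇ toℕ b)
  inArc-> {b} v b<a with ≤-<-connex (toℕ a) (toℕ v)
  ... | inj₁ a≤v
    rewrite inArc-shift (cwDist-unwrap a≤v) (cwDist-wrap b<a)
          | ≤ᵇ-true (≤-trans (<⇒≤ (toℕ<n v)) (m≤n+m (suc m) (toℕ b)))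
          | ≤ᵇ-false (<-≤-trans b<a a≤v)
          = trans (∧-identityʳ _) (sym (∨-identityʳ _))
  ... | inj₂ v<a
    rewrite inArc-shift (cwDist-wrap v<a) (cwDist-wrap b<a)
          | <ᵇ-true (≤-trans (toℕ<n a) (m≤n+m (suc m) (toℕ v)))
          | <ᵇ-false (<⇒≤ v<a)
          = sym (≤ᵇ-+ʳ (suc m) {toℕ v} {toℕ b})

parityBelow : List (Fin n) → ℕ → Bool
parityBelow []       k = false
parityBelow (c ∷ cs) k = (toℕ c <ᵇ k) xor parityBelow cs k

parityBelow-allAbove : ∀ {cs : List (Fin n)} → All (λ c → k ≤ toℕ c) cs → parityBelow cs k ≡ false
parityBelow-allAbove []           = refl
parityBelow-allAbove (k≤c ∷ k≤cs) = cong₂ _xor_ (<ᵇ-false k≤c) (parityBelow-allAbove k≤cs)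

data EvenLength {A : Set} : List A → Set where
  []    : EvenLength []
  cons₂ : ∀ {x y xs} → EvenLength xs → EvenLength (x ∷ y ∷ xs)

parityBelow≡false⇒EvenLength : ∀ {cs : List (Fin n)} → parityBelow cs n ≡ false → EvenLength cs
parityBelow≡false⇒EvenLength {cs = []}         _ = []
parityBelow≡false⇒EvenLength {cs = c ∷ []}     p rewrite <ᵇ-true (toℕ<n c) = contradiction p λ ()
parityBelow≡false⇒EvenLength {cs = c ∷ d ∷ cs} p rewrite <ᵇ-true (toℕ<n c) | <ᵇ-true (toℕ<n d) =
  cons₂ (parityBelow≡false⇒EvenLength (trans (sym (not-involutive _)) p))

Increasing : List (Fin n) → Set
Increasing = AllPairs Fin._<_

inArcs : List (Fin n × Fin n) → Fin n → Bool
inArcs ps v = any (λ (a , b) → inArc a b v) ps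

lookup-unionArcs : ∀ (ps : List (Fin n × Fin n)) → lookup (unionArcs ps) ≗ inArcs ps
lookup-unionArcs ps = lookup∘tabulate (inArcs ps)

module _ {m : ℕ} (v : Fin (suc m)) where

  inArc∨parityBelow : ∀ {a b cs} → Increasing (a ∷ b ∷ cs) →
    inArc a b v ∨ parityBelow cs (toℕ v) ≡ parityBelow (a ∷ b ∷ cs) (toℕ v)
  inArc∨parityBelow {a} {b} ((a<b ∷ _) ∷ b<cs ∷ _) with ≤-<-connex (toℕ v) (toℕ b)
  ... | inj₁ v≤b
    rewrite inArc-≤ v (<⇒≤ a<b) | ≤ᵇ-true v≤b | <ᵇ-false v≤b
          | parityBelow-allAbove (All.map (λ b<c → ≤-trans v≤b (<⇒≤ b<c)) b<cs)
          = trans (∨-identityʳ _) (trans (∧-identityʳ _) (sym (xor-identityʳ _)))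
  ... | inj₂ b<v
    rewrite inArc-≤ v (<⇒≤ a<b) | ≤ᵇ-false b<v | <ᵇ-true b<v | <ᵇ-true (<-trans a<b b<v)
          = sym (not-involutive _)

  inArcs-pairsUp : ∀ {xs} → Increasing xs → EvenLength xs → inArcs (pairsUp xs) v ≡ parityBelow xs (toℕ v)
  inArcs-pairsUp _ [] = refl
  inArcs-pairsUp {a ∷ b ∷ cs} abcs@(_ ∷ _ ∷ cs↑) (cons₂ cs-even) =
    trans (cong (inArc a b v ∨_) (inArcs-pairsUp cs↑ cs-even)) (inArc∨parityBelow abcs)

  open Algebra.Properties.CommutativeSemigroup (CommutativeMonoid.commutativeSemigroup ∨-commutativeMonoid)
    using (x∙yz≈y∙xz)

  -- The last pair ends at c, which precedes its start, so its arc wraps past node 0.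
  inArcs-pairsUp-wrap : ∀ {c y zs} → Increasing (c ∷ y ∷ zs) → EvenLength zs →
    inArcs (pairsUp (y ∷ zs ++ [ c ])) v ≡ (toℕ v ≤ᵇ toℕ c) ∨ parityBelow (y ∷ zs) (toℕ v)
  inArcs-pairsUp-wrap {c} {y} ((c<y ∷ _) ∷ _) [] = begin
    inArc y c v ∨ false                             ≡⟨ ∨-identityʳ _ ⟩
    inArc y c v                                     ≡⟨ inArc-> v c<y ⟩
    (toℕ y <ᵇ toℕ v) ∨ (toℕ v ≤ᵇ toℕ c)             ≡⟨ ∨-comm (toℕ y <ᵇ toℕ v) _ ⟩
    (toℕ v ≤ᵇ toℕ c) ∨ (toℕ y <ᵇ toℕ v)             ≡⟨ cong ((toℕ v ≤ᵇ toℕ c) ∨_) (xor-identityʳ _) ⟨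
    (toℕ v ≤ᵇ toℕ c) ∨ ((toℕ y <ᵇ toℕ v) xor false) ∎
  inArcs-pairsUp-wrap {c} {y} {z₁ ∷ z₂ ∷ zs} ((_ ∷ _ ∷ c<z₂zs) ∷ yz₁z₂zs@(_ ∷ _ ∷ z₂zs↑)) (cons₂ zs-even) =
    begin
    inArc y z₁ v ∨ inArcs (pairsUp (z₂ ∷ zs ++ [ c ])) v
      ≡⟨ cong (inArc y z₁ v ∨_) (inArcs-pairsUp-wrap (c<z₂zs ∷ z₂zs↑) zs-even) ⟩
    inArc y z₁ v ∨ ((toℕ v ≤ᵇ toℕ c) ∨ parityBelow (z₂ ∷ zs) (toℕ v))
      ≡⟨ x∙yz≈y∙xz (inArc y z₁ v) (toℕ v ≤ᵇ toℕ c) _ ⟩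
    (toℕ v ≤ᵇ toℕ c) ∨ (inArc y z₁ v ∨ parityBelow (z₂ ∷ zs) (toℕ v))
      ≡⟨ cong ((toℕ v ≤ᵇ toℕ c) ∨_) (inArc∨parityBelow yz₁z₂zs) ⟩
    (toℕ v ≤ᵇ toℕ c) ∨ parityBelow (y ∷ z₁ ∷ z₂ ∷ zs) (toℕ v)
      ∎

  inArcs-pairsUp-rotL : ∀ {c₁ c₂ zs} → Increasing (c₁ ∷ c₂ ∷ zs) → EvenLength zs →
    inArcs (pairsUp (rotL (c₁ ∷ c₂ ∷ zs))) v ≡ not (parityBelow (c₁ ∷ c₂ ∷ zs) (toℕ v))
  inArcs-pairsUp-rotL {c₁} c₁c₂zs@(c₁<c₂zs ∷ _) zs-even
    rewrite inArcs-pairsUp-wrap c₁c₂zs zs-even with ≤-<-connex (toℕ v) (toℕ c₁)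
  ... | inj₁ v≤c₁ rewrite ≤ᵇ-true v≤c₁ | <ᵇ-false v≤c₁ =
    cong not (sym (parityBelow-allAbove (All.map (λ c₁<c → ≤-trans v≤c₁ (<⇒≤ c₁<c)) c₁<c₂zs)))
  ... | inj₂ c₁<v rewrite ≤ᵇ-false c₁<v | <ᵇ-true c₁<v = sym (not-involutive _)

unionArcs-isSmallerSideOf : ∀ {m} {xs : List (Fin (suc m))} {S} → Increasing xs → EvenLength xs →
  (S ≡ unionArcs (pairsUp xs) × ∣ unionArcs (pairsUp xs) ∣ ≤ ∣ unionArcs (pairsUp (rotL xs)) ∣) ⊎
  (S ≡ unionArcs (pairsUp (rotL xs)) × ∣ unionArcs (pairsUp (rotL xs)) ∣ ≤ ∣ unionArcs (pairsUp xs) ∣) →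
  IsSmallerSideOf (λ v → parityBelow xs (toℕ v)) S
unionArcs-isSmallerSideOf {S = S} _ [] S≡ =
  empty-isSmallerSideOf S (λ _ → refl)
    (λ v → trans (cong (λ T → lookup T v) ([ proj₁ , proj₁ ]′ S≡)) (lookup-unionArcs [] v))
unionArcs-isSmallerSideOf {xs = xs} xs↑ xs-even@(cons₂ zs-even) =
  smallerOf-isSmallerSideOf _ _
    (λ v → trans (lookup-unionArcs (pairsUp xs) v) (inArcs-pairsUp v xs↑ xs-even))
    (λ v → trans (lookup-unionArcs (pairsUp (rotL xs)) v) (inArcs-pairsUp-rotL v xs↑ zs-even))

prefixXor : (Fin n → Bool) → ℕ → Bool
prefixXor g k = foldr _xor_ false (λ i → g i ∧ (toℕ i <ᵇ k))

parityBelow-filter : ∀ {n′} (g : Fin n → Bool) (f : Fin n′ → Fin n) k →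
  parityBelow (filter (λ e → g e ≟B true) (List.tabulate f)) k
    ≡ foldr _xor_ false (λ i → g (f i) ∧ (toℕ (f i) <ᵇ k))
parityBelow-filter {n′ = zero}  g f k = refl
parityBelow-filter {n′ = suc _} g f k with g (f zero)
... | true  = cong ((toℕ (f zero) <ᵇ k) xor_) (parityBelow-filter g (f ∘ suc) k)
... | false = parityBelow-filter g (f ∘ suc) k

prefixXor-zero : ∀ (g : Fin n → Bool) → prefixXor g 0 ≡ false
prefixXor-zero {zero}  g = refl
prefixXor-zero {suc n} g = cong₂ _xor_ (∧-zeroʳ (g zero)) (prefixXor-zero (g ∘ suc))

prefixXor-suc : ∀ (g : Fin n → Bool) (k<n : k < n) → prefixXor g (suc k) ≡ prefixXor g k xor g (fromℕ< k<n)
prefixXor-suc {suc n} {zero} g _ = begin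
  (g zero ∧ true) xor prefixXor (g ∘ suc) 0 ≡⟨ cong₂ _xor_ (∧-identityʳ (g zero)) (prefixXor-zero (g ∘ suc)) ⟩
  g zero xor false                          ≡⟨ xor-identityʳ (g zero) ⟩
  g zero                                    ≡⟨ cong (_xor g zero) (prefixXor-zero g) ⟨
  prefixXor g 0 xor g zero                  ∎
prefixXor-suc {suc n} {suc k} g k+1<n = begin
  (g zero ∧ true) xor prefixXor (g ∘ suc) (suc k)
    ≡⟨ cong ((g zero ∧ true) xor_) (prefixXor-suc (g ∘ suc) (s<s⁻¹ k+1<n)) ⟩
  (g zero ∧ true) xor (prefixXor (g ∘ suc) k xor g (fromℕ< k+1<n))
    ≡⟨ xor-assoc (g zero ∧ true) _ _ ⟨
  ((g zero ∧ true) xor prefixXor (g ∘ suc) k) xor g (fromℕ< k+1<n)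
    ∎

xor-telescope : ∀ x y z → (x xor y) xor (y xor z) ≡ x xor z
xor-telescope x y z = begin
  (x xor y) xor (y xor z) ≡⟨ xor-assoc x y (y xor z) ⟩
  x xor (y xor (y xor z)) ≡⟨ cong (x xor_) (xor-assoc y y z) ⟨
  x xor ((y xor y) xor z) ≡⟨ cong (λ w → x xor (w xor z)) (xor-same y) ⟩
  x xor z                 ∎

module _ {m : ℕ} where

  toℕ-next : ∀ (i : Fin (suc m)) → toℕ (next i) ≡ suc (toℕ i) % suc m
  toℕ-next i = toℕ-fromℕ< _

  next-fromℕ< : ∀ {k} (k+1<n : suc k < suc m) → next (fromℕ< (<-trans (n<1+n k) k+1<n)) ≡ fromℕ< k+1<n
  next-fromℕ< {k} k+1<n = toℕ-injective (begin
    toℕ (next (fromℕ< _))        ≡⟨ toℕ-next _ ⟩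
    suc (toℕ (fromℕ< _)) % suc m ≡⟨ cong (λ i → suc i % suc m) (toℕ-fromℕ< _) ⟩
    suc k % suc m                ≡⟨ m<n⇒m%n≡m k+1<n ⟩
    suc k                        ≡⟨ toℕ-fromℕ< k+1<n ⟨
    toℕ (fromℕ< k+1<n)           ∎)

  next-last : next (fromℕ< (n<1+n m)) ≡ zero
  next-last = toℕ-injective (begin
    toℕ (next (fromℕ< (n<1+n m)))        ≡⟨ toℕ-next _ ⟩
    suc (toℕ (fromℕ< (n<1+n m))) % suc m ≡⟨ cong (λ i → suc i % suc m) (toℕ-fromℕ< (n<1+n m)) ⟩
    suc m % suc m                        ≡⟨ n%n≡0 (suc m) ⟩
    0                                    ∎)

  -- A discrete fundamental theorem of calculus around the cycle, g being the derivative of D.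
  module _ (D : Fin (suc m) → Bool) {g : Fin (suc m) → Bool} (g≗ : ∀ e → g e ≡ D e xor D (next e)) where

    prefixXor-telescope     : (k<n : k < suc m) → prefixXor g k ≡ D zero xor D (fromℕ< k<n)
    prefixXor-telescope-suc : (k<n : k < suc m) → prefixXor g (suc k) ≡ D zero xor D (next (fromℕ< k<n))

    prefixXor-telescope {zero}  _     = trans (prefixXor-zero g) (sym (xor-same (D zero)))
    prefixXor-telescope {suc k} k+1<n =
      trans (prefixXor-telescope-suc (<-trans (n<1+n k) k+1<n))
            (cong (λ i → D zero xor D i) (next-fromℕ< k+1<n))

    prefixXor-telescope-suc {k} k<n = begin
      prefixXor g (suc k)                       ≡⟨ prefixXor-suc g k<n ⟩
      prefixXor g k xor g i                     ≡⟨ cong₂ _xor_ (prefixXor-telescope k<n) (g≗ i) ⟩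
      (D zero xor D i) xor (D i xor D (next i)) ≡⟨ xor-telescope (D zero) (D i) (D (next i)) ⟩
      D zero xor D (next i)                     ∎
      where i = fromℕ< k<n

    prefixXor-all : prefixXor g (suc m) ≡ false
    prefixXor-all = begin
      prefixXor g (suc m)                    ≡⟨ prefixXor-telescope-suc (n<1+n m) ⟩
      D zero xor D (next (fromℕ< (n<1+n m))) ≡⟨ cong (λ i → D zero xor D i) next-last ⟩
      D zero xor D zero                      ≡⟨ xor-same (D zero) ⟩
      false                                  ∎

not-does-≟≡xor : ∀ x y → not (does (x ≟B y)) ≡ x xor y
not-does-≟≡xor false false = refl
not-does-≟≡xor false true  = refl
not-does-≟≡xor true  false = refl
not-does-≟≡xor true  true  = refl

∧-not≡xor : ∀ {x y} → (y ≡ true → x ≡ true) → x ∧ not y ≡ x xor y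
∧-not≡xor {false} {false} _   = refl
∧-not≡xor {false} {true}  y⇒x = contradiction (y⇒x refl) λ ()
∧-not≡xor {true}          _   = refl

lookup-CutEdges : ∀ (χ : Coloring n) → lookup (CutEdges χ) ≗ isCut χ
lookup-CutEdges χ = lookup∘tabulate (isCut χ)

isCut-⊆ : ∀ {χ χ′ : Coloring n} {e} → CutEdges χ ⊆ CutEdges χ′ → isCut χ e ≡ true → isCut χ′ e ≡ true
isCut-⊆ {χ = χ} {χ′} {e} sub cut =
  trans (sym (lookup-CutEdges χ′ e)) ([]=⇒lookup (sub (lookup⇒[]= e _ (trans (lookup-CutEdges χ e) cut))))

isDiffEdge : Coloring n → Coloring n → Fin n → Bool
isDiffEdge χOPT χOFF e = isCut χOPT e ∧ not (isCut χOFF e)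

module _ (χOPT χOFF : Coloring n) where

  open Algebra.Properties.CommutativeSemigroup (CommutativeRing.+-commutativeSemigroup xor-∧-commutativeRing)
    using (interchange)

  isDiffEdge≡xor : CutEdges χOFF ⊆ CutEdges χOPT →
    ∀ e → isDiffEdge χOPT χOFF e ≡ disagree χOPT χOFF e xor disagree χOPT χOFF (next e)
  isDiffEdge≡xor sub e = begin
    isCut χOPT e ∧ not (isCut χOFF e)
      ≡⟨ ∧-not≡xor (isCut-⊆ {χ = χOFF} {χOPT} {e} sub) ⟩
    isCut χOPT e xor isCut χOFF e
      ≡⟨ cong₂ _xor_ (not-does-≟≡xor (χOPT e) _) (not-does-≟≡xor (χOFF e) _) ⟩
    (χOPT e xor χOPT (next e)) xor (χOFF e xor χOFF (next e))
      ≡⟨ interchange (χOPT e) _ _ _ ⟩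
    (χOPT e xor χOFF e) xor (χOPT (next e) xor χOFF (next e))
      ∎

  diffEdges-increasing : Increasing (diffEdges χOPT χOFF)
  diffEdges-increasing = AllPairs.filter⁺ _ (AllPairs.tabulate⁺-< id)

  diffEdges-[] : CutEdges χOPT ≡ CutEdges χOFF → diffEdges χOPT χOFF ≡ []
  diffEdges-[] same = filter-none _ (All.universal notDiffEdge (allFin n))
    where
    notDiffEdge : ∀ e → isDiffEdge χOPT χOFF e ≢ true
    notDiffEdge e diff = contradiction (begin
      true                              ≡⟨ diff ⟨
      isCut χOPT e ∧ not (isCut χOFF e) ≡⟨ cong (λ c → isCut χOPT e ∧ not c) sameCut ⟨
      isCut χOPT e ∧ not (isCut χOPT e) ≡⟨ ∧-inverseʳ (isCut χOPT e) ⟩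
      false                             ∎) λ ()
      where
      sameCut : isCut χOPT e ≡ isCut χOFF e
      sameCut = trans (sym (lookup-CutEdges χOPT e))
                      (trans (cong (λ C → lookup C e) same) (lookup-CutEdges χOFF e))

module _ {m : ℕ} (χOPT χOFF : Coloring (suc m)) (sub : CutEdges χOFF ⊆ CutEdges χOPT) where

  parityBelow-diffEdges : (k<n : k < suc m) →
    parityBelow (diffEdges χOPT χOFF) k ≡ disagree χOPT χOFF zero xor disagree χOPT χOFF (fromℕ< k<n)
  parityBelow-diffEdges k<n = trans (parityBelow-filter (isDiffEdge χOPT χOFF) id _)
    (prefixXor-telescope (disagree χOPT χOFF) (isDiffEdge≡xor χOPT χOFF sub) k<n)

  diffEdges-even : EvenLength (diffEdges χOPT χOFF)
  diffEdges-even = parityBelow≡false⇒EvenLength (trans (parityBelow-filter (isDiffEdge χOPT χOFF) id _)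
    (prefixXor-all (disagree χOPT χOFF) (isDiffEdge≡xor χOPT χOFF sub)))

lemma7 : (n : ℕ) → 3 ≤ n → (χOPT χOFF : Coloring n) →
         CutEdges χOFF ⊆ CutEdges χOPT →
         (Φ : Subset n) → IsPhi χOPT χOFF Φ →
         IsMinRecoloring χOFF χOPT Φ
lemma7 zero ()
lemma7 (suc m) _ χOPT χOFF sub Φ (Φ-same , Φ-differ) =
  smallerSide⇒isMinRecoloring (D zero) parity≡ Φ-smaller
  where
  D = disagree χOPT χOFF
  parity : Fin (suc m) → Bool
  parity v = parityBelow (diffEdges χOPT χOFF) (toℕ v)

  parity≡ : ∀ v → parity v ≡ D zero xor D v
  parity≡ v = trans (parityBelow-diffEdges χOPT χOFF sub (toℕ<n v))
                    (cong ((D zero xor_) ∘ D) (fromℕ<-toℕ v _))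

  Φ-smaller : IsSmallerSideOf parity Φ
  Φ-smaller with ≡-dec _≟B_ (CutEdges χOPT) (CutEdges χOFF)
  ... | yes same = empty-isSmallerSideOf Φ
    (λ v → cong (λ xs → parityBelow xs (toℕ v)) (diffEdges-[] χOPT χOFF same))
    (λ v → trans (cong (λ T → lookup T v) (Φ-same same)) (lookup-replicate v false))
  ... | no differ = unionArcs-isSmallerSideOf
    (diffEdges-increasing χOPT χOFF) (diffEdges-even χOPT χOFF sub) (Φ-differ differ)
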